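{- Let $m > 1$ be an integer, and let $(\lambda_1, \ldots, \lambda_m)$ be a sequence of integers with $\lambda_1 \geq \cdots \geq \lambda_m > 0$ and $\lambda_1 > 1$. Define $(\mu_1, \ldots, \mu_{2m-1})$ by \[\mu_k = \max_{\substack{1 \leq i, j \leq m \\ i + j - 1 = k}} (\lambda_i + \lambda_j - 1), \qquad 1 \leq k \leq 2m-1.\] Then \[\sum_{k=1}^{2m-1} \mu_k \geq 3\left(\sum_{k=1}^m \lambda_k\right) - 3.\] -}

module Defs where

open import Data.Nat using (ℕ; _+_; _∸_; _⊔_; _≟_)
open import Data.Fin using (Fin; toℕ)
open import Data.List using (List; foldr; filter; allFin; cartesianProduct; map; upTo)
open import Data.Nat.ListAction using (sum)
open import Data.Product using (_×_; _,_; proj₁; proj₂)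
open import Relation.Nullary.Decidable using (⌊_⌋)
open import Data.Bool using (Bool; if_then_else_)

-- Indices are 0-based: λ i (i : Fin m) is λ_{i+1} of the paper,
-- and μ λ k (k : ℕ) is μ_{k+1}; the condition i + j - 1 = k becomes i + j = k.

pairs : (m : ℕ) → List (Fin m × Fin m)
pairs m = cartesianProduct (allFin m) (allFin m)

-- max over a list of naturals (0 for the empty list; all values here are ≥ 1)
maxList : List ℕ → ℕ
maxList = foldr _⊔_ 0

μ : {m : ℕ} → (Fin m → ℕ) → ℕ → ℕ
μ {m} lam k =
  maxList (map (λ p → lam (proj₁ p) + lam (proj₂ p) ∸ 1)
               (filter (λ p → toℕ (proj₁ p) + toℕ (proj₂ p) ≟ k) (pairs m)))

sumUpTo : ℕ → (ℕ → ℕ) → ℕ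
sumUpTo n f = sum (map f (upTo n))

sumFin : {m : ℕ} → (Fin m → ℕ) → ℕ
sumFin {m} lam = sum (map lam (allFin m))

module Submission where

-- Call a sequence M : ℕ → ℕ a *dominating sequence* for λ when
-- λ_i + λ_j ≤ M_{i+j} + 1 for all indices i, j; μ is one (the least one).
-- We show, for every antitone positive λ of length m = n + 2 with λ_0 ≥ 2 and
-- every dominating M, that 3 Σ_j λ_j ≤ 3 + Σ_{k < 2m-1} M_k, by induction on n:
--   * m = 2: add up the three bounds for the pairs (0,0), (0,1), (1,1);
--   * λ_1 ≥ 2: the tail (λ_1, …, λ_{m-1}) satisfies the hypotheses and is
--     dominated by M shifted by two, and the pairs (0,0), (0,1) give
--     3 λ_0 ≤ M_0 + M_1 because λ_1 ≥ 2;
--   * λ_1 = 1: then λ_j = 1 for all j ≥ 1; the pairs (0,0), (0,k) and (m-1,k)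
--     give M_0 + 1 ≥ 2λ_0, M_k ≥ λ_0 for 1 ≤ k ≤ m-1 and M_k ≥ 1 for
--     m ≤ k ≤ 2m-2, and the claim reduces to (m-2)(λ_0-2) ≥ 0.
-- The file first develops sums over ranges and over Fin, then the notion of
-- dominating sequence, then the three cases, and finally lemmaA1.

open import Defs
open import Data.Nat using (ℕ; suc; _+_; _*_; _∸_; _<_) renaming (_≤_ to _≤ℕ_)
open import Data.Fin using (Fin; zero; fromℕ) renaming (_≤_ to _≤F_)

open import Data.Nat using (_≤_; z≤n; s≤s; s≤s⁻¹; _≤?_)
open import Data.Nat.Properties
open import Data.Nat.Tactic.RingSolver using (solve-∀)
open import Data.Nat.ListAction using (sum)
open import Data.Fin using (toℕ; fromℕ<) renaming (suc to fsuc)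
open import Data.Fin.Properties using (toℕ-fromℕ<; toℕ-fromℕ; ≤fromℕ)
open import Data.List using (_∷_; tabulate; applyUpTo)
open import Data.List.Properties using (map-tabulate; map-upTo)
open import Data.List.Membership.Propositional using (_∈_)
open import Data.List.Membership.Propositional.Properties
  using (∈-filter⁺; ∈-map⁺; ∈-cartesianProduct⁺; ∈-allFin)
open import Data.List.Relation.Unary.Any using (here; there)
open import Function using (_∘_)
open import Relation.Binary.PropositionalEquality
open import Relation.Nullary using (yes; no)

-- Σ_{k < n} f k, written so that it unfolds at the front:
-- sumBelow (suc n) f = f 0 + sumBelow n (f ∘ suc) holds by computation.
sumBelow : ℕ → (ℕ → ℕ) → ℕ
sumBelow n f = sum (applyUpTo f n)

sumUpTo≡sumBelow : ∀ n (f : ℕ → ℕ) → sumUpTo n f ≡ sumBelow n f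
sumUpTo≡sumBelow n f = cong sum (map-upTo f n)

sumFin≡sum-tabulate : ∀ {m} (f : Fin m → ℕ) → sumFin f ≡ sum (tabulate f)
sumFin≡sum-tabulate f = cong sum (map-tabulate (λ i → i) f)

sumBelow-split : ∀ a b f → sumBelow (a + b) f ≡ sumBelow a f + sumBelow b (λ k → f (a + k))
sumBelow-split 0       b f = refl
sumBelow-split (suc a) b f =
  trans (cong (f 0 +_) (sumBelow-split a b (f ∘ suc))) (sym (+-assoc (f 0) _ _))

sumBelow-≥ : ∀ a c f → (∀ k → k < a → c ≤ f k) → a * c ≤ sumBelow a f
sumBelow-≥ 0       c f bound = z≤n
sumBelow-≥ (suc a) c f bound =
  +-mono-≤ (bound 0 (s≤s z≤n)) (sumBelow-≥ a c (f ∘ suc) (λ k k<a → bound (suc k) (s≤s k<a)))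

sum-tabulate-≤ : ∀ {m} c (f : Fin m → ℕ) → (∀ i → f i ≤ c) → sum (tabulate f) ≤ m * c
sum-tabulate-≤ {0}  c f bound = z≤n
sum-tabulate-≤ {suc m} c f bound =
  +-mono-≤ (bound zero) (sum-tabulate-≤ c (f ∘ fsuc) (bound ∘ fsuc))

Antitone : {m : ℕ} → (Fin m → ℕ) → Set
Antitone lam = ∀ i j → i ≤F j → lam j ≤ lam i

Positive : {m : ℕ} → (Fin m → ℕ) → Set
Positive lam = ∀ j → 1 ≤ lam j

Dominates : {m : ℕ} → (Fin m → ℕ) → (ℕ → ℕ) → Set
Dominates lam M = ∀ i j → lam i + lam j ≤ suc (M (toℕ i + toℕ j))

antitone-positive : ∀ {m} (lam : Fin (suc m) → ℕ) → Antitone lam → 0 < lam (fromℕ m) → Positive lam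
antitone-positive lam anti last j = ≤-trans last (anti j _ (≤fromℕ j))

maxList-≥ : ∀ {x} xs → x ∈ xs → x ≤ maxList xs
maxList-≥ (y ∷ ys) (here refl) = m≤m⊔n y _
maxList-≥ (y ∷ ys) (there x∈ys) = m≤n⇒m≤o⊔n y (maxList-≥ ys x∈ys)

μ-dominates : ∀ {m} (lam : Fin m → ℕ) → Dominates lam (μ lam)
μ-dominates lam i j = ≤-trans (m≤n+m∸n (lam i + lam j) 1) (s≤s (maxList-≥ _ pair∈))
  where
  pair∈ = ∈-map⁺ _ (∈-filter⁺ _ (∈-cartesianProduct⁺ (∈-allFin i) (∈-allFin j)) refl)

dominates-tail : ∀ {m} (lam : Fin (suc m) → ℕ) M → Dominates lam M → Dominates (lam ∘ fsuc) (M ∘ suc ∘ suc)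
dominates-tail lam M dom i j =
  subst (λ k → lam (fsuc i) + lam (fsuc j) ≤ suc (M (suc k))) (+-suc (toℕ i) (toℕ j)) (dom (fsuc i) (fsuc j))

dominated-entry : ∀ {m} (lam : Fin m → ℕ) M → Dominates lam M
  → ∀ i j → 1 ≤ lam j → ∀ {k} → toℕ i + toℕ j ≡ k → lam i ≤ M k
dominated-entry lam M dom i j pos refl = s≤s⁻¹ (begin
  suc (lam i)      ≡⟨ +-comm 1 (lam i) ⟩
  lam i + 1        ≤⟨ +-monoʳ-≤ (lam i) pos ⟩
  lam i + lam j    ≤⟨ dom i j ⟩
  suc (M (toℕ i + toℕ j)) ∎)
  where open ≤-Reasoning

-- Number of terms 2m - 1 for a family of length m = n + 2.
width : ℕ → ℕ
width n = suc (suc n + suc n)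

width-suc : ∀ n → width (suc n) ≡ suc (suc (width n))
width-suc n = cong (suc ∘ suc ∘ suc) (+-suc n (suc n))

width≡ : ∀ n → 2 * suc (suc n) ∸ 1 ≡ width n
width≡ n = cong suc (trans (+-suc n (suc (n + 0))) (cong (suc ∘ (n +_) ∘ suc) (+-identityʳ n)))

base-case : (lam : Fin 2 → ℕ) → ∀ M → Dominates lam M → 3 * sum (tabulate lam) ≤ 3 + sumBelow (width 0) M
base-case lam M dom = begin
  3 * (x + (y + 0))                   ≡⟨ regroup x y ⟩
  (x + x) + (x + y) + (y + y)         ≤⟨ +-mono-≤ (+-mono-≤ (dom zero zero) (dom zero one)) (dom one one) ⟩
  suc (M 0) + suc (M 1) + suc (M 2)   ≡⟨ collect (M 0) (M 1) (M 2) ⟩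
  3 + (M 0 + (M 1 + (M 2 + 0)))       ∎
  where
  open ≤-Reasoning
  one : Fin 2
  one = fsuc zero
  x = lam zero
  y = lam one
  regroup : ∀ x y → 3 * (x + (y + 0)) ≡ (x + x) + (x + y) + (y + y)
  regroup = solve-∀
  collect : ∀ a b c → suc a + suc b + suc c ≡ 3 + (a + (b + (c + 0)))
  collect = solve-∀

head-bound : ∀ L₀ L₁ M₀ M₁ → L₀ + L₀ ≤ suc M₀ → L₀ + L₁ ≤ suc M₁ → 2 ≤ L₁ → 3 * L₀ ≤ M₀ + M₁
head-bound L₀ L₁ M₀ M₁ d₀₀ d₀₁ two≤L₁ = +-cancelʳ-≤ 2 _ _ (begin
  3 * L₀ + 2              ≡⟨ regroup L₀ ⟩
  (L₀ + L₀) + (L₀ + 2)    ≤⟨ +-mono-≤ d₀₀ (≤-trans (+-monoʳ-≤ L₀ two≤L₁) d₀₁) ⟩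
  suc M₀ + suc M₁         ≡⟨ collect M₀ M₁ ⟩
  M₀ + M₁ + 2             ∎)
  where
  open ≤-Reasoning
  regroup : ∀ x → 3 * x + 2 ≡ (x + x) + (x + 2)
  regroup = solve-∀
  collect : ∀ a b → suc a + suc b ≡ a + b + 2
  collect = solve-∀

peel-case : ∀ n (lam : Fin (suc (suc (suc n))) → ℕ) M → Dominates lam M → 2 ≤ lam (fsuc zero)
  → 3 * sum (tabulate (lam ∘ fsuc)) ≤ 3 + sumBelow (width n) (M ∘ suc ∘ suc)
  → 3 * sum (tabulate lam) ≤ 3 + sumBelow (width (suc n)) M
peel-case n lam M dom two≤λ₁ ih = begin
  3 * (L₀ + T)              ≡⟨ *-distribˡ-+ 3 L₀ T ⟩
  3 * L₀ + 3 * T            ≤⟨ +-mono-≤ (head-bound L₀ _ (M 0) (M 1) (dom zero zero) (dom zero (fsuc zero)) two≤λ₁) ih ⟩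
  (M 0 + M 1) + (3 + R)     ≡⟨ collect (M 0) (M 1) R ⟩
  3 + (M 0 + (M 1 + R))     ≡⟨ cong (λ w → 3 + sumBelow w M) (sym (width-suc n)) ⟩
  3 + sumBelow (width (suc n)) M ∎
  where
  open ≤-Reasoning
  L₀ = lam zero
  T = sum (tabulate (lam ∘ fsuc))
  R = sumBelow (width n) (M ∘ suc ∘ suc)
  collect : ∀ a b r → (a + b) + (3 + r) ≡ 3 + (a + (b + r))
  collect = solve-∀

-- The arithmetic of the remaining case: (c - 1)(L - 2) ≥ 0 for c ≥ 1, L ≥ 2.
middle-bound : ∀ n L → 2 ≤ L → L + 2 * suc n ≤ suc n * L + 2
middle-bound n L two≤L = begin
  L + 2 * suc n     ≡⟨ regroup n L ⟩
  L + n * 2 + 2     ≤⟨ +-monoˡ-≤ 2 (+-monoʳ-≤ L (*-monoʳ-≤ n two≤L)) ⟩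
  L + n * L + 2     ∎
  where
  open ≤-Reasoning
  regroup : ∀ n L → L + 2 * suc n ≡ L + n * 2 + 2
  regroup = solve-∀

-- λ_1 ≤ 1, so λ_j = 1 for all j ≥ 1.  Split the 2m - 1 terms as
-- M_0 ≥ 2λ_0 - 1, then m - 1 terms M_{1+k} ≥ λ_0 (pairs (0, 1+k)),
-- then m - 1 terms M_{m+k} ≥ 1 (pairs (m-1, 1+k)).
flat-case : ∀ n (lam : Fin (suc (suc n)) → ℕ) M → Antitone lam → Positive lam → Dominates lam M
  → 2 ≤ lam zero → lam (fsuc zero) ≤ 1
  → 3 * sum (tabulate lam) ≤ 3 + sumBelow (width n) M
flat-case n lam M anti pos dom two≤λ₀ λ₁≤1 = begin
  3 * (L₀ + T)                          ≤⟨ *-monoʳ-≤ 3 (+-monoʳ-≤ L₀ T≤c) ⟩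
  3 * (L₀ + c)                          ≡⟨ regroup L₀ c ⟩
  (L₀ + L₀) + (L₀ + 2 * c) + c          ≤⟨ +-mono-≤ (+-mono-≤ (dom zero zero) (middle-bound n L₀ two≤λ₀)) B≥c ⟩
  suc (M 0) + (c * L₀ + 2) + B          ≤⟨ +-monoˡ-≤ B (+-monoʳ-≤ (suc (M 0)) (+-monoˡ-≤ 2 A≥cL₀)) ⟩
  suc (M 0) + (A + 2) + B               ≡⟨ collect (M 0) A B ⟩
  3 + (M 0 + (A + B))                   ≡⟨ cong (λ s → 3 + (M 0 + s)) (sym (sumBelow-split c c (M ∘ suc))) ⟩
  3 + sumBelow (width n) M              ∎
  where
  open ≤-Reasoning
  c = suc n
  L₀ = lam zero
  T = sum (tabulate (lam ∘ fsuc))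
  A = sumBelow c (M ∘ suc)
  B = sumBelow c (λ k → M (suc (c + k)))
  T≤c : T ≤ c
  T≤c = ≤-trans (sum-tabulate-≤ 1 (lam ∘ fsuc) (λ i → ≤-trans (anti (fsuc zero) (fsuc i) (s≤s z≤n)) λ₁≤1))
                (≤-reflexive (*-identityʳ c))
  A≥cL₀ : c * L₀ ≤ A
  A≥cL₀ = sumBelow-≥ c L₀ (M ∘ suc) λ k k<c →
    dominated-entry lam M dom zero (fsuc (fromℕ< k<c)) (pos _) (cong suc (toℕ-fromℕ< k<c))
  B≥c : c ≤ B
  B≥c = ≤-trans (≤-reflexive (sym (*-identityʳ c))) (sumBelow-≥ c 1 _ λ k k<c →
    ≤-trans (pos _) (dominated-entry lam M dom (fromℕ c) (fsuc (fromℕ< k<c)) (pos _)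
      (trans (cong₂ (λ a b → a + suc b) (toℕ-fromℕ c) (toℕ-fromℕ< k<c)) (cong suc (+-suc n k)))))
  regroup : ∀ x c → 3 * (x + c) ≡ (x + x) + (x + 2 * c) + c
  regroup = solve-∀
  collect : ∀ m a b → suc m + (a + 2) + b ≡ 3 + (m + (a + b))
  collect = solve-∀

dominated-sum : ∀ n (lam : Fin (suc (suc n)) → ℕ) M → Antitone lam → Positive lam → Dominates lam M
  → 2 ≤ lam zero → 3 * sum (tabulate lam) ≤ 3 + sumBelow (width n) M
dominated-sum 0       lam M anti pos dom two≤λ₀ = base-case lam M dom
dominated-sum (suc n) lam M anti pos dom two≤λ₀ with 2 ≤? lam (fsuc zero)
... | no  λ₁≱2 = flat-case (suc n) lam M anti pos dom two≤λ₀ (s≤s⁻¹ (≰⇒> λ₁≱2))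
... | yes two≤λ₁ = peel-case n lam M dom two≤λ₁
  (dominated-sum n (lam ∘ fsuc) (M ∘ suc ∘ suc)
    (λ i j i≤j → anti (fsuc i) (fsuc j) (s≤s i≤j)) (pos ∘ fsuc) (dominates-tail lam M dom) two≤λ₁)

lemmaA1 : (n : ℕ) → (lam : Fin (suc (suc n)) → ℕ)
          → (∀ (i j : Fin (suc (suc n))) → i ≤F j → lam j ≤ℕ lam i)
          → 0 < lam (fromℕ (suc n))
          → 1 < lam zero
          → 3 * sumFin lam ∸ 3 ≤ℕ sumUpTo (2 * suc (suc n) ∸ 1) (μ lam)
lemmaA1 n lam anti last two≤λ₀ = m≤n+o⇒m∸n≤o (3 * sumFin lam) 3 (begin
  3 * sumFin lam                          ≡⟨ cong (3 *_) (sumFin≡sum-tabulate lam) ⟩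
  3 * sum (tabulate lam)                  ≤⟨ dominated-sum n lam (μ lam) anti (antitone-positive lam anti last)
                                                             (μ-dominates lam) two≤λ₀ ⟩
  3 + sumBelow (width n) (μ lam)          ≡⟨ cong (λ w → 3 + sumBelow w (μ lam)) (sym (width≡ n)) ⟩
  3 + sumBelow (2 * suc (suc n) ∸ 1) (μ lam) ≡⟨ cong (3 +_) (sym (sumUpTo≡sumBelow (2 * suc (suc n) ∸ 1) (μ lam))) ⟩
  3 + sumUpTo (2 * suc (suc n) ∸ 1) (μ lam) ∎)
  where open ≤-Reasoning
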